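{- Let $\mathcal{R}=\mathcal{R}_0\oplus\mathcal{R}_1$ be a supercommutative ring, let $a_2,a_3,\ldots\in\mathcal{R}_0$ and $\beta_1,\beta_2,\ldots\in\mathcal{R}_1$. For $n\ge2$ let $P_n=\mathcal{E}[(\beta_1,\beta_2,\beta_2,\ldots,\beta_{n-1},\beta_{n-1},\beta_n)]$ (word of length $2n-2$), set $P_1=1$, and for $n\ge1$ let $Q_n=\mathcal{E}[(\beta_1,\beta_2,\beta_2,\ldots,\beta_n,\beta_n)]$ (word of length $2n-1$; so $Q_1=\beta_1$), where $\mathcal{E}$ is defined in the context. Then: (i) for all $n\ge 2$, $P_n=-\beta_nQ_{n-1}+P_{n-1}$; (ii) for all $n\ge 2$, $P_n=\det{}_{\mathrm{col}}\, T_n$, where $T_n=(t_{ij})_{1\le i,j\le n}$ is the $n\times n$ matrix with first row $t_{1j}=\beta_j$ for $1\le j\le n-1$ and $t_{1n}=1$; for $2\le i\le n-1$: $t_{i,i-1}=-1$, $t_{ii}=a_i$, $t_{i,i+1}=-1+\beta_i\beta_{i+1}$ if $i+1\le n-1$, $t_{ij}=\beta_i\beta_j$ for $i+2\le j\le n-1$, $t_{in}=\beta_i$, and $t_{ij}=0$ for $j\le i-2$; last row $t_{n,n-1}=-1$, $t_{nn}=\beta_n$, $t_{nj}=0$ for $j\le n-2$. That is, $$P_n=\begin{vmatrix} \beta_1 & \beta_2 & \beta_3 & \cdots & \beta_{n-1} & 1\\ -1 & a_2 & -1+\beta_2\beta_3 & \cdots & \beta_2\beta_{n-1} & \beta_2\\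 0&-1&a_3&\cdots&\beta_3\beta_{n-1}&\beta_3\\ \cdots&\cdots&\cdots&\cdots&\cdots&\cdots\\ 0&\cdots&0&-1&a_{n-1}&\beta_{n-1}\\ 0&\cdots&0&0&-1&\beta_n\end{vmatrix}_{\mathrm{col}}.$$
   Context: A supercommutative ring satisfies $xy=(-1)^{|x||y|}yx$ for homogeneous $x,y$ and $x^2=0$ for odd $x$. Rule (definition of $\mathcal{E}$): Let $w=(w_1,\ldots,w_m)$ be a word with letters among $\beta_1,\beta_2,\ldots$, and write $\iota(p)$ for the index of the letter at position $p$; in the words considered, adjacent positions satisfy $\iota(p+1)\in\{\iota(p),\iota(p)+1\}$. An admissible marking of $w$ is a partition of $\{1,\ldots,m\}$ into blocks of consecutive positions, each a singleton $\{p\}$, a pair $\{p,p+1\}$, or a quadruple $\{p,\ldots,p+3\}$ with $\iota(p)=\iota(p+1)=i$, $\iota(p+2)=\iota(p+3)=i+1$ for some $i$. The weight of a pair $\{p,p+1\}$ is $a_i$ if $\iota(p)=\iota(p+1)=i$ and $1$ if $\iota(p+1)=\iota(p)+1$; the weight of a quadruple is $-1$. The monomial of a marking is the product of the weights of its pairs and quadruples times $\beta_{\iota(p_1)}\cdots\beta_{\iota(p_k)}$, where $p_1<\cdots<p_k$ are its singleton positions in increasing order. $\mathcal{E}[w]$ is the sum of the monomials over all admissible markings (the empty word has value $1$). For example $P_2=\beta_1\beta_2+1$ and $P_3=a_2\beta_1\beta_3+\beta_1\beta_2+\beta_2\beta_3+1$. Column-expansion determinant: for a $1\times1$ matrix,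 $\det_{\mathrm{col}}(t)=t$; for a $k\times k$ matrix $T$ with $k\ge2$, $\det_{\mathrm{col}}T=\sum_{i=1}^k(-1)^{i+1}\,t_{i1}\cdot\det_{\mathrm{col}}(T^{(i,1)})$, where $T^{(i,1)}$ is $T$ with row $i$ and column $1$ deleted and the entry $t_{i1}$ is written to the left of the minor (i.e. the determinant is always expanded along the first column, recursively). -}

module Defs where

open import Level using (Level; _⊔_) renaming (suc to lsuc)
open import Algebra.Bundles using (Ring)
open import Data.Nat using (ℕ; zero; suc; _≟_; _≤?_)
open import Data.Fin using (Fin; toℕ; punchIn) renaming (zero to fzero; suc to fsuc)
open import Data.List using (List; []; _∷_; [_]; map; _++_; foldr)
open import Data.Bool using (Bool; true; false; if_then_else_; _∧_)
open import Data.Product using (∃; ∃-syntax; _×_; _,_)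
open import Relation.Nullary.Decidable using (⌊_⌋)

record SuperCommRing (c ℓ : Level) : Set (lsuc (c ⊔ ℓ)) where
  field
    ring : Ring c ℓ
  open Ring ring public
  field
    Even Odd  : Carrier → Set ℓ
    even-resp : ∀ {x y} → x ≈ y → Even x → Even y
    odd-resp  : ∀ {x y} → x ≈ y → Odd x → Odd y
    even-0    : Even 0#
    odd-0     : Odd 0#
    even-+    : ∀ {x y} → Even x → Even y → Even (x + y)
    odd-+     : ∀ {x y} → Odd x → Odd y → Odd (x + y)
    even-neg  : ∀ {x} → Even x → Even (- x)
    odd-neg   : ∀ {x} → Odd x → Odd (- x)
    decomp    : ∀ x → ∃[ e ] ∃[ o ] (Even e × Odd o × x ≈ e + o)
    direct    : ∀ {x} → Even x → Odd x → x ≈ 0#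
    even-1    : Even 1#
    even*even : ∀ {x y} → Even x → Even y → Even (x * y)
    even*odd  : ∀ {x y} → Even x → Odd y → Odd (x * y)
    odd*even  : ∀ {x y} → Odd x → Even y → Odd (x * y)
    odd*odd   : ∀ {x y} → Odd x → Odd y → Even (x * y)
    comm-ee   : ∀ {x y} → Even x → Even y → x * y ≈ y * x
    comm-eo   : ∀ {x y} → Even x → Odd y → x * y ≈ y * x
    comm-oe   : ∀ {x y} → Odd x → Even y → x * y ≈ y * x
    comm-oo   : ∀ {x y} → Odd x → Odd y → x * y ≈ - (y * x)
    odd-sq    : ∀ {x} → Odd x → x * x ≈ 0#

-- Words are lists of letter indices (the word (β_{i₁},…,β_{iₘ}) is the
-- list i₁ ∷ … ∷ iₘ ∷ []).

-- Blocks of a marking, recording the letter indices they cover.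
data Block : Set where
  sing : ℕ → Block
  pair : ℕ → ℕ → Block          -- pair {p,p+1} with indices ι(p), ι(p+1)
  quad : ℕ → Block              -- quadruple with indices i,i,i+1,i+1

mutual
  markings : List ℕ → List (List Block)
  markings [] = [ [] ]
  markings (i ∷ []) = [ sing i ∷ [] ]
  markings (i ∷ j ∷ w) =
    map (sing i ∷_) (markings (j ∷ w))
    ++ map (pair i j ∷_) (markings w)
    ++ quadMarkings i j w

  quadMarkings : ℕ → ℕ → List ℕ → List (List Block)
  quadMarkings i j (k ∷ l ∷ w) =
    if ⌊ i ≟ j ⌋ ∧ ⌊ k ≟ l ⌋ ∧ ⌊ k ≟ suc i ⌋
    then map (quad i ∷_) (markings w)
    else []
  quadMarkings i j _ = []

module SC {c ℓ} (S : SuperCommRing c ℓ) where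
  open SuperCommRing S

  ΣFin : (k : ℕ) → (Fin k → Carrier) → Carrier
  ΣFin zero f = 0#
  ΣFin (suc k) f = f fzero + ΣFin k (λ i → f (fsuc i))

  neg1^ : ℕ → Carrier
  neg1^ zero = 1#
  neg1^ (suc n) = (- 1#) * neg1^ n

  -- column-expansion determinant of a (suc m) × (suc m) matrix,
  -- always expanded along the first column, entry written to the left.
  detcol : (m : ℕ) → (Fin (suc m) → Fin (suc m) → Carrier) → Carrier
  detcol zero T = T fzero fzero
  detcol (suc m) T =
    ΣFin (suc (suc m)) (λ i →
      neg1^ (toℕ i) * (T i fzero * detcol m (λ r s → T (punchIn i r) (fsuc s))))

  module Seq (a β : ℕ → Carrier) where

    -- weight of a block (1# for singletons, which contribute via β instead).
    -- Pairs with ι(p+1) ∉ {ι(p), ι(p)+1} never occur in the words considered;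
    -- they get weight 0#.
    weight : Block → Carrier
    weight (sing _) = 1#
    weight (pair i j) =
      if ⌊ i ≟ j ⌋ then a i else if ⌊ j ≟ suc i ⌋ then 1# else 0#
    weight (quad _) = - 1#

    weightProd : List Block → Carrier
    weightProd [] = 1#
    weightProd (sing _ ∷ bs) = weightProd bs
    weightProd (b ∷ bs) = weight b * weightProd bs

    singProd : List Block → Carrier
    singProd [] = 1#
    singProd (sing i ∷ bs) = β i * singProd bs
    singProd (_ ∷ bs) = singProd bs

    monomial : List Block → Carrier
    monomial bs = weightProd bs * singProd bs

    ℰ : List ℕ → Carrier
    ℰ w = foldr _+_ 0# (map monomial (markings w))

    doubles : ℕ → List ℕ
    doubles zero = []
    doubles (suc zero) = []
    doubles (suc (suc k)) = doubles (suc k) ++ (suc (suc k) ∷ suc (suc k) ∷ [])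

    -- P₁ = 1, Pₙ = ℰ[(β₁,β₂,β₂,…,β_{n-1},β_{n-1},βₙ)] for n ≥ 2 (P₀ unused)
    P : ℕ → Carrier
    P zero = 1#
    P (suc zero) = 1#
    P (suc (suc k)) = ℰ (1 ∷ doubles (suc k) ++ [ suc (suc k) ])

    Q : ℕ → Carrier
    Q n = ℰ (1 ∷ doubles n)

    -- entries of Tₙ, 1-based indices i j
    entry : ℕ → ℕ → ℕ → Carrier
    entry n i j =
      if ⌊ i ≟ 1 ⌋ then (if ⌊ j ≟ n ⌋ then 1# else β j)
      else if ⌊ i ≟ n ⌋ then
        (if ⌊ j ≟ n ⌋ then β n else if ⌊ suc j ≟ n ⌋ then - 1# else 0#)
      else
        (if ⌊ j ≟ n ⌋ then β i
         else if ⌊ suc (suc j) ≤? i ⌋ then 0#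
         else if ⌊ suc j ≟ i ⌋ then - 1#
         else if ⌊ j ≟ i ⌋ then a i
         else if ⌊ j ≟ suc i ⌋ then - 1# + β i * β j
         else β i * β j)

    T : (n : ℕ) → Fin n → Fin n → Carrier
    T n i j = entry n (suc (toℕ i)) (suc (toℕ j))

module Submission where

-- Both statements are proved by comparing three sequences with one and
-- the same linear recursion.  Along the words (β₁,β₂,β₂,…) the values
--   Aᵢ = ℰ[βᵢ,βᵢ,…,β_{e-1},β_{e-1},βₑ]   and   Bᵢ = ℰ[βᵢ,β_{i+1},β_{i+1},…,βₑ]
-- satisfy, by expanding ℰ at the first letter,
--   Bᵢ = βᵢ A_{i+1} + B_{i+1},   Aᵢ = βᵢ Bᵢ + aᵢ A_{i+1} − A_{i+2}.
-- We package (Aᵢ, A_{i+1}, Bᵢ) as a triple, so the recursion becomes a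
-- map `step i` on triples, iterated by `run` from a terminal triple.
-- (i)  `run` is right-linear in the terminal triple.  The terminal triple
--      of Pₙ is that of Q_{n-1} times βₙ plus one for P_{n-1}; since Q_{n-1}
--      is odd, Q_{n-1} βₙ = −βₙ Q_{n-1}.
-- (ii) T_n is upper Hessenberg with subdiagonal −1, so expanding along the
--      first column leaves only two terms; the resulting expansions of the
--      trailing windows of T_n obey the same recursion (using βᵢ² = 0)
--      with the same terminal triple as the words of Pₙ.

open import Defs
open import Data.Nat using (ℕ; zero; suc; _≤_; _<_; _∸_; _≟_; _≤?_; s≤s; z≤n)
import Data.Nat as ℕ
import Data.Nat.Properties as ℕₚ
open import Data.Nat.Properties
  using (+-suc; ≤-refl; ≤-trans; <⇒≤; <⇒≢; >⇒≢; <⇒≱; n<1+n; m≤n⇒m≤1+n; m<m+n; m≤n⇒m<n∨m≡n)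
open import Data.Fin using (Fin; toℕ; punchIn) renaming (zero to fzero; suc to fsuc)
open import Data.Fin.Properties using (toℕ<n)
open import Data.Bool using (Bool; true; false; if_then_else_; _∧_)
open import Data.List using (List; []; _∷_; [_]; map; _++_; foldr)
open import Data.List.Relation.Unary.All using (All; []; _∷_) renaming (map to All-map)
open import Data.List.Relation.Unary.All.Properties using (++⁺; map⁺)
open import Data.Product using (_×_; _,_; proj₁; proj₂)
open import Data.Sum using (_⊎_; inj₁; inj₂)
open import Relation.Nullary using (¬_; Dec; yes; no; contradiction)
open import Relation.Nullary.Decidable using (⌊_⌋)
open import Relation.Binary.PropositionalEquality
  using (_≡_; _≢_; refl; sym; trans; cong; cong₂; subst)

⌊⌋-yes : ∀ {p} {P : Set p} (d : Dec P) → P → ⌊ d ⌋ ≡ true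
⌊⌋-yes (yes _) _ = refl
⌊⌋-yes (no ¬p) p = contradiction p ¬p

⌊⌋-no : ∀ {p} {P : Set p} (d : Dec P) → ¬ P → ⌊ d ⌋ ≡ false
⌊⌋-no (yes p) ¬p = contradiction p ¬p
⌊⌋-no (no _) _ = refl

if-yes : ∀ {a p} {A : Set a} {P : Set p} (d : Dec P) {x y : A} →
         P → (if ⌊ d ⌋ then x else y) ≡ x
if-yes d {x} {y} p = cong (λ b → if b then x else y) (⌊⌋-yes d p)

if-no : ∀ {a p} {A : Set a} {P : Set p} (d : Dec P) {x y : A} →
        ¬ P → (if ⌊ d ⌋ then x else y) ≡ y
if-no d {x} {y} ¬p = cong (λ b → if b then x else y) (⌊⌋-no d ¬p)

-- Equality of naturals as a sum, for case splits that must not disturb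
-- the conditionals `⌊ m ≟ n ⌋` occurring in a goal.
≡-or-≢ : ∀ m n → m ≡ n ⊎ m ≢ n
≡-or-≢ m n with m ≟ n
... | yes m≡n = inj₁ m≡n
... | no m≢n = inj₂ m≢n

ladder : (ℕ → List ℕ) → ℕ → ℕ → List ℕ
ladder end i zero = end i
ladder end i (suc k) = i ∷ i ∷ ladder end (suc i) k

ladder-rung : ∀ end k i → ladder (λ j → j ∷ j ∷ end (suc j)) i k ≡ ladder end i (suc k)
ladder-rung end zero i = refl
ladder-rung end (suc k) i = cong (λ w → i ∷ i ∷ w) (ladder-rung end k (suc i))

ladder-split : ∀ end k i → ladder (λ _ → []) i k ++ end (i ℕ.+ k) ≡ ladder end i k
ladder-split end zero i = cong end (ℕₚ.+-identityʳ i)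
ladder-split end (suc k) i =
  cong (λ w → i ∷ i ∷ w) (trans (cong (λ j → ladder (λ _ → []) (suc i) k ++ end j) (+-suc i k))
                                (ladder-split end k (suc i)))

ladder-letters : ∀ end → (∀ j → 2 ≤ j → All (2 ≤_) (end j)) →
                 ∀ k i → 2 ≤ i → All (2 ≤_) (ladder end i k)
ladder-letters end h zero i i≥2 = h i i≥2
ladder-letters end h (suc k) i i≥2 = i≥2 ∷ i≥2 ∷ ladder-letters end h k (suc i) (m≤n⇒m≤1+n i≥2)

module Development {c ℓ} (S : SuperCommRing c ℓ) where
  open SuperCommRing S renaming (refl to ≈-refl; sym to ≈-sym; trans to ≈-trans)
  open SC S
  open import Algebra.Properties.Ring ring using (-1*x≈-x; -‿distribˡ-*; -‿+-comm; -0#≈0#; -‿involutive)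
  open import Algebra.Properties.CommutativeSemigroup +-commutativeSemigroup
    using (interchange; x∙yz≈y∙xz)
  open import Relation.Binary.Reasoning.Setoid setoid

  *-over-lin : ∀ p x c y → p * (x * c + y) ≈ (p * x) * c + p * y
  *-over-lin p x c y = ≈-trans (distribˡ p (x * c) y) (+-cong (≈-sym (*-assoc p x c)) ≈-refl)

  +-over-lin : ∀ x c x′ y y′ → (x * c + x′) + (y * c + y′) ≈ (x + y) * c + (x′ + y′)
  +-over-lin x c x′ y y′ =
    ≈-trans (interchange (x * c) x′ (y * c) y′) (+-cong (≈-sym (distribʳ c x y)) ≈-refl)

  neg-over-lin : ∀ x c x′ → - (x * c + x′) ≈ (- x) * c + - x′
  neg-over-lin x c x′ =
    ≈-trans (≈-sym (-‿+-comm (x * c) x′)) (+-cong (-‿distribˡ-* x c) ≈-refl)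

  nilpotent-absorb : ∀ x u v → x * x ≈ 0# → x * (x * u + v) ≈ x * v
  nilpotent-absorb x u v x²≈0 = begin
    x * (x * u + v)      ≈⟨ *-over-lin x x u v ⟩
    (x * x) * u + x * v  ≈⟨ +-cong (≈-trans (*-cong x²≈0 ≈-refl) (zeroˡ u)) ≈-refl ⟩
    0# + x * v           ≈⟨ +-identityˡ (x * v) ⟩
    x * v                ∎

  -- Column determinants of upper Hessenberg matrices.

  ΣFin-cong : ∀ m {f g : Fin m → Carrier} → (∀ i → f i ≈ g i) → ΣFin m f ≈ ΣFin m g
  ΣFin-cong zero h = ≈-refl
  ΣFin-cong (suc m) h = +-cong (h fzero) (ΣFin-cong m (λ i → h (fsuc i)))

  ΣFin-zero : ∀ m {f : Fin m → Carrier} → (∀ i → f i ≈ 0#) → ΣFin m f ≈ 0#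
  ΣFin-zero zero h = ≈-refl
  ΣFin-zero (suc m) h = ≈-trans (+-cong (h fzero) (ΣFin-zero m (λ i → h (fsuc i)))) (+-identityˡ 0#)

  detcol-cong : ∀ m {A B : Fin (suc m) → Fin (suc m) → Carrier} →
                (∀ i j → A i j ≈ B i j) → detcol m A ≈ detcol m B
  detcol-cong zero h = h fzero fzero
  detcol-cong (suc m) h = ΣFin-cong (suc (suc m)) λ i →
    *-cong (≈-refl {neg1^ (toℕ i)}) (*-cong (h i fzero) (detcol-cong m (λ r s → h (punchIn i r) (fsuc s))))

  stacked : (s : ℕ) → (ℕ → Carrier) → (ℕ → ℕ → Carrier) → Fin (suc s) → Fin (suc s) → Carrier
  stacked s f R fzero j = f (toℕ j)
  stacked s f R (fsuc r) j = R (toℕ r) (toℕ j)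

  shift : (ℕ → ℕ → Carrier) → ℕ → ℕ → Carrier
  shift R r c = R (suc r) (suc c)

  -- What the column expansion of `stacked s f R` reduces to when the rows R
  -- have −1 on the subdiagonal and 0 below it: only the first two entries of
  -- the first column contribute.
  hess : ℕ → (ℕ → Carrier) → (ℕ → ℕ → Carrier) → Carrier
  hess zero f R = f 0
  hess (suc s) f R = f 0 * hess s (λ j → R 0 (suc j)) (shift R) + hess s (λ j → f (suc j)) (shift R)

  hess-cong : ∀ s {f g : ℕ → Carrier} {R R′ : ℕ → ℕ → Carrier} →
              (∀ j → f j ≡ g j) → (∀ r c → R r c ≡ R′ r c) → hess s f R ≡ hess s g R′
  hess-cong zero hf hR = hf 0
  hess-cong (suc s) hf hR =
    cong₂ _+_ (cong₂ _*_ (hf 0) (hess-cong s (λ j → hR 0 (suc j)) (λ r c → hR (suc r) (suc c))))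
              (hess-cong s (λ j → hf (suc j)) (λ r c → hR (suc r) (suc c)))

  detcol-hessenberg : ∀ s f R →
    (∀ c → c < s → R c c ≈ - 1#) → (∀ r c → c < r → r < s → R r c ≈ 0#) →
    detcol s (stacked s f R) ≈ hess s f R
  detcol-hessenberg zero f R sub low = ≈-refl
  detcol-hessenberg (suc s) f R sub low = begin
    1# * (f 0 * detcol s minor₀) + ((- 1# * 1#) * (R 0 0 * detcol s minor₁) + ΣFin s rest)
      ≈⟨ +-cong (≈-trans (*-identityˡ _) (*-cong ≈-refl expand₀))
                (+-cong expand₁ (ΣFin-zero s rest≈0)) ⟩
    f 0 * hess s (λ j → R 0 (suc j)) (shift R) + (hess s (λ j → f (suc j)) (shift R) + 0#)
      ≈⟨ +-cong ≈-refl (+-identityʳ _) ⟩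
    hess (suc s) f R ∎
    where
    M : Fin (suc (suc s)) → Fin (suc (suc s)) → Carrier
    M = stacked (suc s) f R
    minor₀ minor₁ : Fin (suc s) → Fin (suc s) → Carrier
    minor₀ r c = M (punchIn fzero r) (fsuc c)
    minor₁ r c = M (punchIn (fsuc fzero) r) (fsuc c)
    rest : Fin s → Carrier
    rest i = neg1^ (toℕ (fsuc (fsuc i))) *
             (M (fsuc (fsuc i)) fzero * detcol s (λ r c → M (punchIn (fsuc (fsuc i)) r) (fsuc c)))

    shift-sub : ∀ c → c < s → shift R c c ≈ - 1#
    shift-sub c c<s = sub (suc c) (s≤s c<s)
    shift-low : ∀ r c → c < r → r < s → shift R r c ≈ 0#
    shift-low r c c<r r<s = low (suc r) (suc c) (s≤s c<r) (s≤s r<s)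

    minor₀≡ : ∀ r c → minor₀ r c ≡ stacked s (λ j → R 0 (suc j)) (shift R) r c
    minor₀≡ fzero c = refl
    minor₀≡ (fsuc r) c = refl
    minor₁≡ : ∀ r c → minor₁ r c ≡ stacked s (λ j → f (suc j)) (shift R) r c
    minor₁≡ fzero c = refl
    minor₁≡ (fsuc r) c = refl

    expand₀ : detcol s minor₀ ≈ hess s (λ j → R 0 (suc j)) (shift R)
    expand₀ = ≈-trans (detcol-cong s (λ r c → reflexive (minor₀≡ r c)))
                      (detcol-hessenberg s _ (shift R) shift-sub shift-low)
    expand₁ : (- 1# * 1#) * (R 0 0 * detcol s minor₁) ≈ hess s (λ j → f (suc j)) (shift R)
    expand₁ = begin
      (- 1# * 1#) * (R 0 0 * detcol s minor₁)
        ≈⟨ *-cong (*-identityʳ (- 1#))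
                  (*-cong (sub 0 (s≤s z≤n))
                          (≈-trans (detcol-cong s (λ r c → reflexive (minor₁≡ r c)))
                                   (detcol-hessenberg s _ (shift R) shift-sub shift-low))) ⟩
      - 1# * (- 1# * hess s (λ j → f (suc j)) (shift R))
        ≈⟨ ≈-trans (-1*x≈-x _) (-‿cong (-1*x≈-x _)) ⟩
      - (- hess s (λ j → f (suc j)) (shift R))
        ≈⟨ -‿involutive _ ⟩
      hess s (λ j → f (suc j)) (shift R) ∎
    rest≈0 : ∀ i → rest i ≈ 0#
    rest≈0 i = ≈-trans (*-cong ≈-refl (≈-trans (*-cong (low (suc (toℕ i)) 0 (s≤s z≤n) (s≤s (toℕ<n i))) ≈-refl)
                                                (zeroˡ _)))
                       (zeroʳ _)

  -- The same expansion, for the window of rows R l, R (l+1), … (with first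
  -- row f) and columns l, l+1, …, of a matrix indexed by ℕ.
  expand : (ℕ → ℕ → Carrier) → ℕ → ℕ → (ℕ → Carrier) → Carrier
  expand R l zero f = f l
  expand R l (suc s) f = f l * expand R (suc l) s (R (suc l)) + expand R (suc l) s f

  hess-window : ∀ R s l f →
    hess s (λ j → f (l ℕ.+ j)) (λ r c → R (suc (l ℕ.+ r)) (l ℕ.+ c)) ≡ expand R l s f
  hess-window R zero l f = cong f (ℕₚ.+-identityʳ l)
  hess-window R (suc s) l f =
    cong₂ _+_ (cong₂ _*_ (cong f (ℕₚ.+-identityʳ l))
                         (trans (hess-cong s (λ j → cong₂ R (cong suc (ℕₚ.+-identityʳ l)) (+-suc l j)) rows)
                                (hess-window R s (suc l) (R (suc l)))))
              (trans (hess-cong s (λ j → cong f (+-suc l j)) rows) (hess-window R s (suc l) f))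
    where
    rows : ∀ r c → R (suc (l ℕ.+ suc r)) (l ℕ.+ suc c) ≡ R (suc (suc l ℕ.+ r)) (suc l ℕ.+ c)
    rows r c = cong₂ R (cong suc (+-suc l r)) (+-suc l c)

  expand-linear : ∀ R s l {f g : ℕ → Carrier} x →
    (∀ j → l ≤ j → f j ≈ x * g j) → expand R l s f ≈ x * expand R l s g
  expand-linear R zero l x h = h l ≤-refl
  expand-linear R (suc s) l {f} {g} x h = begin
    f l * E + expand R (suc l) s f
      ≈⟨ +-cong (*-cong (h l ≤-refl) ≈-refl) (expand-linear R s (suc l) x (λ j l<j → h j (<⇒≤ l<j))) ⟩
    (x * g l) * E + x * expand R (suc l) s g
      ≈⟨ +-cong (*-assoc x (g l) E) ≈-refl ⟩
    x * (g l * E) + x * expand R (suc l) s g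
      ≈⟨ distribˡ x _ _ ⟨
    x * (g l * E + expand R (suc l) s g) ∎
    where
    E : Carrier
    E = expand R (suc l) s (R (suc l))

  module Ladder (a β : ℕ → Carrier) where
    open Seq a β

    -- The triple recursion.

    -- At level i a triple stands for (Aᵢ, A_{i+1}, Bᵢ).
    record Triple : Set c where
      constructor ⟦_,_,_⟧
      field main next side : Carrier
    open Triple

    infix 4 _≋_
    _≋_ : Triple → Triple → Set ℓ
    s ≋ t = main s ≈ main t × next s ≈ next t × side s ≈ side t

    ≋-reflexive : ∀ {s t} → s ≡ t → s ≋ t
    ≋-reflexive refl = ≈-refl , ≈-refl , ≈-refl

    ≋-trans : ∀ {s t u} → s ≋ t → t ≋ u → s ≋ u
    ≋-trans (p , q , r) (p′ , q′ , r′) = ≈-trans p p′ , ≈-trans q q′ , ≈-trans r r′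

    -- One level down: B = β A′ + B′ and A = β B + a A′ − A″.
    step : ℕ → Triple → Triple
    step i ⟦ x , y , z ⟧ = ⟦ β i * (β i * x + z) + (a i * x + - y) , x , β i * x + z ⟧

    -- `run i k s`: the triple at level i, given the triple s at level i+k.
    run : ℕ → ℕ → Triple → Triple
    run i zero s = s
    run i (suc k) s = step i (run (suc i) k s)

    step-cong : ∀ i {s t} → s ≋ t → step i s ≋ step i t
    step-cong i {s} {t} (p , q , r) = +-cong (*-cong ≈-refl side≈) (+-cong (*-cong ≈-refl p) (-‿cong q)) , p , side≈
      where
      side≈ : β i * main s + side s ≈ β i * main t + side t
      side≈ = +-cong (*-cong ≈-refl p) r

    run-cong : ∀ k i {s t} → s ≋ t → run i k s ≋ run i k t
    run-cong zero i eq = eq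
    run-cong (suc k) i eq = step-cong i (run-cong k (suc i) eq)

    run-peel : ∀ i k s → run i (suc k) s ≡ run i k (step (i ℕ.+ k) s)
    run-peel i zero s = cong (λ j → step j s) (sym (ℕₚ.+-identityʳ i))
    run-peel i (suc k) s =
      cong (step i) (trans (run-peel (suc i) k s) (cong (λ j → run (suc i) k (step j s)) (sym (+-suc i k))))

    infixl 7 _⊙_
    infixl 6 _⊞_
    _⊙_ : Triple → Carrier → Triple
    ⟦ x , y , z ⟧ ⊙ γ = ⟦ x * γ , y * γ , z * γ ⟧
    _⊞_ : Triple → Triple → Triple
    ⟦ x , y , z ⟧ ⊞ ⟦ x′ , y′ , z′ ⟧ = ⟦ x + x′ , y + y′ , z + z′ ⟧

    step-linear : ∀ i s t γ → step i (s ⊙ γ ⊞ t) ≋ step i s ⊙ γ ⊞ step i t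
    step-linear i ⟦ x , y , z ⟧ ⟦ x′ , y′ , z′ ⟧ γ = main≈ , ≈-refl , side≈
      where
      side≈ : β i * (x * γ + x′) + (z * γ + z′) ≈ (β i * x + z) * γ + (β i * x′ + z′)
      side≈ = ≈-trans (+-cong (*-over-lin (β i) x γ x′) ≈-refl) (+-over-lin (β i * x) γ (β i * x′) z z′)
      main≈ : main (step i (⟦ x , y , z ⟧ ⊙ γ ⊞ ⟦ x′ , y′ , z′ ⟧))
              ≈ main (step i ⟦ x , y , z ⟧ ⊙ γ ⊞ step i ⟦ x′ , y′ , z′ ⟧)
      main≈ = begin
        β i * (β i * (x * γ + x′) + (z * γ + z′)) + (a i * (x * γ + x′) + - (y * γ + y′))
          ≈⟨ +-cong (≈-trans (*-cong ≈-refl side≈) (*-over-lin (β i) _ γ _))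
                    (≈-trans (+-cong (*-over-lin (a i) x γ x′) (neg-over-lin y γ y′))
                             (+-over-lin (a i * x) γ (a i * x′) (- y) (- y′))) ⟩
        (β i * (β i * x + z)) * γ + β i * (β i * x′ + z′) + ((a i * x + - y) * γ + (a i * x′ + - y′))
          ≈⟨ +-over-lin _ γ _ _ _ ⟩
        (β i * (β i * x + z) + (a i * x + - y)) * γ + (β i * (β i * x′ + z′) + (a i * x′ + - y′)) ∎

    run-linear : ∀ k i s t γ → run i k (s ⊙ γ ⊞ t) ≋ run i k s ⊙ γ ⊞ run i k t
    run-linear zero i s t γ = ≈-refl , ≈-refl , ≈-refl
    run-linear (suc k) i s t γ =
      ≋-trans (step-cong i (run-linear k (suc i) s t γ)) (step-linear i (run (suc i) k s) (run (suc i) k t) γ)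

    middleRow : ℕ → ℕ → ℕ → Carrier
    middleRow n i j =
      if ⌊ j ≟ n ⌋ then β i
      else if ⌊ suc (suc j) ≤? i ⌋ then 0#
      else if ⌊ suc j ≟ i ⌋ then - 1#
      else if ⌊ j ≟ i ⌋ then a i
      else if ⌊ j ≟ suc i ⌋ then - 1# + β i * β j
      else β i * β j

    lastRow : ℕ → ℕ → Carrier
    lastRow n j = if ⌊ j ≟ n ⌋ then β n else if ⌊ suc j ≟ n ⌋ then - 1# else 0#

    entry-first : ∀ n {j} → j ≢ n → entry n 1 j ≡ β j
    entry-first n j≢n = if-no (_ ≟ n) j≢n

    entry-first-last : ∀ n → entry n 1 n ≡ 1#
    entry-first-last n = if-yes (n ≟ n) refl

    entry-middle : ∀ n {i} j → 2 ≤ i → i < n → entry n i j ≡ middleRow n i j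
    entry-middle n j 1<i i<n = trans (if-no (_ ≟ 1) (>⇒≢ 1<i)) (if-no (_ ≟ n) (<⇒≢ i<n))

    entry-last : ∀ n j → 2 ≤ n → entry n n j ≡ lastRow n j
    entry-last n j 1<n = trans (if-no (n ≟ 1) (>⇒≢ 1<n)) (if-yes (n ≟ n) refl)

    entry-corner : ∀ n → 2 ≤ n → entry n n n ≡ β n
    entry-corner n 1<n = trans (entry-last n n 1<n) (if-yes (n ≟ n) refl)

    entry-sub : ∀ n c → suc (suc c) ≤ n → entry n (suc (suc c)) (suc c) ≡ - 1#
    entry-sub n c c+2≤n with m≤n⇒m<n∨m≡n c+2≤n
    ... | inj₁ c+2<n = trans (entry-middle n (suc c) (s≤s (s≤s z≤n)) c+2<n)
      (trans (if-no (suc c ≟ n) (<⇒≢ (<⇒≤ c+2<n)))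
      (trans (if-no (suc (suc (suc c)) ≤? suc (suc c)) (<⇒≱ (n<1+n _)))
             (if-yes (suc (suc c) ≟ suc (suc c)) refl)))
    ... | inj₂ refl = trans (entry-last (suc (suc c)) (suc c) (s≤s (s≤s z≤n)))
      (trans (if-no (suc c ≟ suc (suc c)) (<⇒≢ (n<1+n _)))
             (if-yes (suc (suc c) ≟ suc (suc c)) refl))

    entry-low : ∀ n {r c} → c < r → suc (suc r) ≤ n → entry n (suc (suc r)) (suc c) ≡ 0#
    entry-low n {r} {c} c<r r+2≤n with m≤n⇒m<n∨m≡n r+2≤n
    ... | inj₁ r+2<n = trans (entry-middle n (suc c) (s≤s (s≤s z≤n)) r+2<n)
      (trans (if-no (suc c ≟ n) (<⇒≢ (≤-trans (s≤s (s≤s (<⇒≤ c<r))) (<⇒≤ r+2<n))))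
             (if-yes (suc (suc (suc c)) ≤? suc (suc r)) (s≤s (s≤s c<r))))
    ... | inj₂ refl = trans (entry-last (suc (suc r)) (suc c) (s≤s (s≤s z≤n)))
      (trans (if-no (suc c ≟ suc (suc r)) (<⇒≢ (s≤s (m≤n⇒m≤1+n c<r))))
             (if-no (suc (suc c) ≟ suc (suc r)) (<⇒≢ (s≤s (s≤s c<r)))))

    entry-diag : ∀ n i → 2 ≤ i → i < n → entry n i i ≡ a i
    entry-diag n i 1<i i<n = trans (entry-middle n i 1<i i<n)
      (trans (if-no (i ≟ n) (<⇒≢ i<n))
      (trans (if-no (suc (suc i) ≤? i) (<⇒≱ (m≤n⇒m≤1+n (n<1+n i))))
      (trans (if-no (suc i ≟ i) (>⇒≢ (n<1+n i)))
             (if-yes (i ≟ i) refl))))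

    entry-super : ∀ n i → 2 ≤ i → suc i < n → entry n i (suc i) ≡ - 1# + β i * β (suc i)
    entry-super n i 1<i i+1<n = trans (entry-middle n (suc i) 1<i (<⇒≤ i+1<n))
      (trans (if-no (suc i ≟ n) (<⇒≢ i+1<n))
      (trans (if-no (suc (suc (suc i)) ≤? i) (<⇒≱ (m≤n⇒m≤1+n (m≤n⇒m≤1+n (n<1+n i)))))
      (trans (if-no (suc (suc i) ≟ i) (>⇒≢ (m≤n⇒m≤1+n (n<1+n i))))
      (trans (if-no (suc i ≟ i) (>⇒≢ (n<1+n i)))
             (if-yes (suc i ≟ suc i) refl)))))

    entry-column : ∀ n i → 2 ≤ i → i < n → entry n i n ≡ β i
    entry-column n i 1<i i<n = trans (entry-middle n n 1<i i<n) (if-yes (n ≟ n) refl)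

    entry-far : ∀ n i j → 2 ≤ i → i < n → suc (suc i) ≤ j → entry n i j ≈ β i * entry n 1 j
    entry-far n i j 1<i i<n i+2≤j with ≡-or-≢ j n
    ... | inj₁ refl = begin
      entry n i n      ≡⟨ entry-column n i 1<i i<n ⟩
      β i              ≈⟨ *-identityʳ (β i) ⟨
      β i * 1#         ≡⟨ cong (β i *_) (sym (entry-first-last n)) ⟩
      β i * entry n 1 n ∎
    ... | inj₂ j≢n = begin
      entry n i j ≡⟨ trans (entry-middle n j 1<i i<n)
                    (trans (if-no (j ≟ n) j≢n)
                    (trans (if-no (suc (suc j) ≤? i) (<⇒≱ (m≤n⇒m≤1+n (m≤n⇒m≤1+n i<j))))
                    (trans (if-no (suc j ≟ i) (>⇒≢ (m≤n⇒m≤1+n i<j)))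
                    (trans (if-no (j ≟ i) (>⇒≢ i<j))
                           (if-no (j ≟ suc i) (>⇒≢ i+2≤j)))))) ⟩
      β i * β j         ≡⟨ cong (β i *_) (sym (entry-first n j≢n)) ⟩
      β i * entry n 1 j ∎
      where
      i<j : i < j
      i<j = <⇒≤ i+2≤j

    module Graded (a-even : ∀ i → 2 ≤ i → Even (a i)) (β-odd : ∀ i → 1 ≤ i → Odd (β i)) where

      β²≈0 : ∀ i → 1 ≤ i → β i * β i ≈ 0#
      β²≈0 i 0<i = odd-sq (β-odd i 0<i)

      EvenPattern : Triple → Set ℓ
      EvenPattern s = Even (main s) × Even (next s) × Odd (side s)

      -- From level 2 on (where aᵢ is even) the recursion preserves the pattern.
      step-parity : ∀ i {s} → 2 ≤ i → EvenPattern s → EvenPattern (step i s)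
      step-parity i {s} 1<i (ex , ey , oz) =
        even-+ (odd*odd βᵢ b-odd) (even-+ (even*even (a-even i 1<i) ex) (even-neg ey)) , ex , b-odd
        where
        βᵢ : Odd (β i)
        βᵢ = β-odd i (<⇒≤ 1<i)
        b-odd : Odd (β i * main s + side s)
        b-odd = odd-+ (odd*even βᵢ ex) oz

      run-parity : ∀ k i {s} → 2 ≤ i → EvenPattern s → EvenPattern (run i k s)
      run-parity zero i 1<i p = p
      run-parity (suc k) i 1<i p = step-parity i 1<i (run-parity k (suc i) (m≤n⇒m≤1+n 1<i) p)

      -- Expanding ℰ at the first letter.

      EvenWeight : List Block → Set ℓ
      EvenWeight bs = Even (weightProd bs)

      if-even : ∀ b {x y} → Even x → Even y → Even (if b then x else y)
      if-even true ex ey = ex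
      if-even false ex ey = ey

      pair-even : ∀ i j → 2 ≤ i → Even (weight (pair i j))
      pair-even i j 1<i = if-even ⌊ i ≟ j ⌋ (a-even i 1<i) (if-even ⌊ j ≟ suc i ⌋ even-1 even-0)

      All-if : ∀ {P : List Block → Set ℓ} b {xs} → All P xs → All P (if b then xs else [])
      All-if true p = p
      All-if false p = []

      -- Markings of words with all letters ≥ 2 carry even weights (no a₁).
      mutual
        markings-even : ∀ w → All (2 ≤_) w → All EvenWeight (markings w)
        markings-even [] _ = even-1 ∷ []
        markings-even (i ∷ []) _ = even-1 ∷ []
        markings-even (i ∷ j ∷ w) (hi ∷ hj ∷ hw) =
          ++⁺ (map⁺ (markings-even (j ∷ w) (hj ∷ hw)))
              (++⁺ (map⁺ (All-map (even*even (pair-even i j hi)) (markings-even w hw)))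
                   (quad-even i j w hw))

        quad-even : ∀ i j w → All (2 ≤_) w → All EvenWeight (quadMarkings i j w)
        quad-even i j [] _ = []
        quad-even i j (k ∷ []) _ = []
        quad-even i j (k ∷ l ∷ w) (_ ∷ _ ∷ hw) =
          All-if (⌊ i ≟ j ⌋ ∧ ⌊ k ≟ l ⌋ ∧ ⌊ k ≟ suc i ⌋)
                 (map⁺ (All-map (even*even (even-neg even-1)) (markings-even w hw)))

      Σm : List (List Block) → Carrier
      Σm xs = foldr _+_ 0# (map monomial xs)

      Σm-++ : ∀ xs ys → Σm (xs ++ ys) ≈ Σm xs + Σm ys
      Σm-++ [] ys = ≈-sym (+-identityˡ _)
      Σm-++ (x ∷ xs) ys = ≈-trans (+-cong ≈-refl (Σm-++ xs ys)) (≈-sym (+-assoc _ _ _))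

      Σm-prefix : ∀ b γ xs → (∀ bs → EvenWeight bs → monomial (b ∷ bs) ≈ γ * monomial bs) →
                  All EvenWeight xs → Σm (map (b ∷_) xs) ≈ γ * Σm xs
      Σm-prefix b γ [] h _ = ≈-sym (zeroʳ γ)
      Σm-prefix b γ (x ∷ xs) h (ex ∷ exs) =
        ≈-trans (+-cong (h x ex) (Σm-prefix b γ xs h exs)) (≈-sym (distribˡ γ _ _))

      -- An odd letter can be pulled out to the left past even weights.
      ℰ-cons : ∀ i j w → 1 ≤ i → All (2 ≤_) (j ∷ w) →
        ℰ (i ∷ j ∷ w) ≈ β i * ℰ (j ∷ w) + (weight (pair i j) * ℰ w + Σm (quadMarkings i j w))
      ℰ-cons i j w 0<i hjw@(hj ∷ hw) = begin
        ℰ (i ∷ j ∷ w)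
          ≈⟨ Σm-++ (map (sing i ∷_) (markings (j ∷ w))) _ ⟩
        Σm (map (sing i ∷_) (markings (j ∷ w))) + Σm (map (pair i j ∷_) (markings w) ++ quadMarkings i j w)
          ≈⟨ +-cong (Σm-prefix (sing i) (β i) _ singleton (markings-even (j ∷ w) hjw))
                    (≈-trans (Σm-++ (map (pair i j ∷_) (markings w)) _)
                             (+-cong (Σm-prefix (pair i j) _ _ (λ bs _ → *-assoc _ _ _) (markings-even w hw))
                                     ≈-refl)) ⟩
        β i * ℰ (j ∷ w) + (weight (pair i j) * ℰ w + Σm (quadMarkings i j w)) ∎
        where
        singleton : ∀ bs → EvenWeight bs → monomial (sing i ∷ bs) ≈ β i * monomial bs
        singleton bs e = begin
          weightProd bs * (β i * singProd bs)  ≈⟨ *-assoc _ _ _ ⟨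
          (weightProd bs * β i) * singProd bs  ≈⟨ *-cong (comm-eo e (β-odd i 0<i)) ≈-refl ⟩
          (β i * weightProd bs) * singProd bs  ≈⟨ *-assoc _ _ _ ⟩
          β i * monomial bs                    ∎

      ℰ-empty : ℰ [] ≈ 1#
      ℰ-empty = ≈-trans (+-identityʳ _) (*-identityˡ 1#)

      ℰ-single : ∀ i → ℰ [ i ] ≈ β i
      ℰ-single i = ≈-trans (+-identityʳ _) (≈-trans (*-identityˡ _) (*-identityʳ (β i)))

      -- A rising pair βᵢβ_{i+1} has weight 1 and starts no quadruple.
      ℰ-ascent : ∀ i w → 1 ≤ i → All (2 ≤_) (suc i ∷ w) → ℰ (i ∷ suc i ∷ w) ≈ β i * ℰ (suc i ∷ w) + ℰ w
      ℰ-ascent i w 0<i hw = ≈-trans (ℰ-cons i (suc i) w 0<i hw)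
        (+-cong ≈-refl (≈-trans (+-cong (*-cong (reflexive weight≡1) ≈-refl) (reflexive (cong Σm (no-quad w))))
                                (≈-trans (+-identityʳ _) (*-identityˡ _))))
        where
        weight≡1 : weight (pair i (suc i)) ≡ 1#
        weight≡1 = trans (if-no (i ≟ suc i) (<⇒≢ (n<1+n i))) (if-yes (suc i ≟ suc i) refl)
        no-quad : ∀ w → quadMarkings i (suc i) w ≡ []
        no-quad [] = refl
        no-quad (k ∷ []) = refl
        no-quad (k ∷ l ∷ w) = cong (λ b → if b ∧ (⌊ k ≟ l ⌋ ∧ ⌊ k ≟ suc i ⌋) then map (quad i ∷_) (markings w) else [])
                                   (⌊⌋-no (i ≟ suc i) (<⇒≢ (n<1+n i)))

      weight-double : ∀ i → weight (pair i i) ≡ a i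
      weight-double i = if-yes (i ≟ i) refl

      -- A doubled letter followed by at most one further letter.
      ℰ-double-short : ∀ i w → 2 ≤ i → All (2 ≤_) w → quadMarkings i i w ≡ [] →
                       ℰ (i ∷ i ∷ w) ≈ β i * ℰ (i ∷ w) + a i * ℰ w
      ℰ-double-short i w 1<i hw no-quad = ≈-trans (ℰ-cons i i w (<⇒≤ 1<i) (1<i ∷ hw))
        (+-cong ≈-refl (≈-trans (+-cong (*-cong (reflexive (weight-double i)) ≈-refl)
                                        (reflexive (cong Σm no-quad)))
                                (+-identityʳ _)))

      -- A doubled letter followed by the next doubled letter starts a quadruple.
      ℰ-double-quad : ∀ i w → 2 ≤ i → All (2 ≤_) w →
        ℰ (i ∷ i ∷ suc i ∷ suc i ∷ w) ≈ β i * ℰ (i ∷ suc i ∷ suc i ∷ w) + (a i * ℰ (suc i ∷ suc i ∷ w) + - ℰ w)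
      ℰ-double-quad i w 1<i hw = ≈-trans (ℰ-cons i i (suc i ∷ suc i ∷ w) (<⇒≤ 1<i) (1<i ∷ 2≤i+1 ∷ 2≤i+1 ∷ hw))
        (+-cong ≈-refl (+-cong (*-cong (reflexive (weight-double i)) ≈-refl) quad-term))
        where
        2≤i+1 : 2 ≤ suc i
        2≤i+1 = m≤n⇒m≤1+n 1<i
        quad≡ : quadMarkings i i (suc i ∷ suc i ∷ w) ≡ map (quad i ∷_) (markings w)
        quad≡ = cong (λ b → if b then map (quad i ∷_) (markings w) else [])
          (cong₂ _∧_ (⌊⌋-yes (i ≟ i) refl) (cong₂ _∧_ (⌊⌋-yes (suc i ≟ suc i) refl) (⌊⌋-yes (suc i ≟ suc i) refl)))
        quad-term : Σm (quadMarkings i i (suc i ∷ suc i ∷ w)) ≈ - ℰ w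
        quad-term = ≈-trans (reflexive (cong Σm quad≡))
          (≈-trans (Σm-prefix (quad i) (- 1#) _ (λ bs _ → *-assoc _ _ _) (markings-even w hw)) (-1*x≈-x _))

      -- Word families: the ladders i,i,…,i+k−1,i+k−1 followed by `end (i+k)`.
      -- σ plays the role of B at the top level, where it is not a value of ℰ.

      module Family (end : ℕ → List ℕ) (σ : Carrier)
        (end-letters : ∀ j → 2 ≤ j → All (2 ≤_) (end j))
        (base-side : ∀ i → 1 ≤ i → ℰ (i ∷ end (suc i)) ≈ β i * ℰ (end (suc i)) + σ)
        (base-main : ∀ i → 2 ≤ i → ℰ (i ∷ i ∷ end (suc i)) ≈ β i * ℰ (i ∷ end (suc i)) + a i * ℰ (end (suc i)))
        where

        state : ℕ → ℕ → Triple
        state i zero = ⟦ ℰ (end i) , 0# , σ ⟧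
        state i (suc k) = ⟦ ℰ (ladder end i (suc k)) , ℰ (ladder end (suc i) k) , ℰ (i ∷ ladder end (suc i) k) ⟧

        main-state : ∀ k i → main (state i k) ≡ ℰ (ladder end i k)
        main-state zero i = refl
        main-state (suc k) i = refl

        lead-letter : ∀ k i → 1 ≤ i → ℰ (i ∷ ladder end (suc i) k) ≈ side (step i (state (suc i) k))
        lead-letter zero i 0<i = base-side i 0<i
        lead-letter (suc k) i 0<i =
          ℰ-ascent i (suc i ∷ ladder end (suc (suc i)) k) 0<i
                   (ladder-letters end end-letters (suc k) (suc i) (s≤s 0<i))

        doubled-letter : ∀ k i → 2 ≤ i →
          ℰ (ladder end i (suc k)) ≈ β i * ℰ (i ∷ ladder end (suc i) k) + (a i * main (state (suc i) k) + - next (state (suc i) k))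
        doubled-letter zero i 1<i = ≈-trans (base-main i 1<i)
          (+-cong ≈-refl (≈-trans (≈-sym (+-identityʳ _)) (+-cong ≈-refl (≈-sym -0#≈0#))))
        doubled-letter (suc k) i 1<i =
          ℰ-double-quad i (ladder end (suc (suc i)) k) 1<i
                        (ladder-letters end end-letters k (suc (suc i)) (m≤n⇒m≤1+n (m≤n⇒m≤1+n 1<i)))

        state-step : ∀ k i → 2 ≤ i → step i (state (suc i) k) ≋ state i (suc k)
        state-step k i 1<i =
          ≈-sym (≈-trans (doubled-letter k i 1<i) (+-cong (*-cong ≈-refl (lead-letter k i (<⇒≤ 1<i))) ≈-refl)) ,
          reflexive (main-state k (suc i)) ,
          ≈-sym (lead-letter k i (<⇒≤ 1<i))

        state-run : ∀ k i → 2 ≤ i → run i k (state (i ℕ.+ k) 0) ≋ state i k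
        state-run zero i 1<i = ≋-reflexive (cong (λ j → state j 0) (ℕₚ.+-identityʳ i))
        state-run (suc k) i 1<i rewrite +-suc i k =
          ≋-trans (step-cong i (state-run k (suc i) (m≤n⇒m≤1+n 1<i))) (state-step k i 1<i)

        leading : ∀ k → ℰ (1 ∷ ladder end 2 k) ≈ side (run 1 (suc k) (state (2 ℕ.+ k) 0))
        leading k = ≈-trans (lead-letter k 1 ≤-refl) (≈-sym (proj₂ (proj₂ (step-cong 1 (state-run k 2 ≤-refl)))))

      -- Words ending with a single letter: Aᵢ = ℰ[βᵢ,βᵢ,…,βₑ], Bₑ = 1.
      module Odd-ended = Family [_] 1# (λ j 1<j → 1<j ∷ [])
        (λ i 0<i → ≈-trans (ℰ-ascent i [] 0<i (s≤s 0<i ∷ [])) (+-cong ≈-refl ℰ-empty))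
        (λ i 1<i → ℰ-double-short i [ suc i ] 1<i (m≤n⇒m≤1+n 1<i ∷ []) refl)

      -- Words ending with a doubled letter: Aᵢ = ℰ[βᵢ,βᵢ,…,β_{e−1},β_{e−1}], Bₑ = 0.
      module Even-ended = Family (λ _ → []) 0# (λ _ _ → [])
        (λ i _ → ≈-trans (ℰ-single i)
                         (≈-sym (≈-trans (+-identityʳ _) (≈-trans (*-cong ≈-refl ℰ-empty) (*-identityʳ (β i))))))
        (λ i 1<i → ℰ-double-short i [] 1<i [] refl)

      -- The trailing windows of Tₙ follow the same recursion.

      module Windows (n : ℕ) where
        R : ℕ → ℕ → Carrier
        R = entry n

        -- (expansion of the window at level l with its own row l,
        --  the same at level l+1, expansion with the first row of Tₙ).
        window-next : ℕ → ℕ → Carrier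
        window-next l zero = 0#
        window-next l (suc s) = expand R (suc l) s (R (suc l))

        window : ℕ → ℕ → Triple
        window l s = ⟦ expand R l s (R l) , window-next l s , expand R l s (R 1) ⟧

        below-n : ∀ {l s} → l ℕ.+ suc s ≡ n → l < n
        below-n {l} {s} eq = subst (l <_) eq (m<m+n l (s≤s z≤n))

        level-up : ∀ {l s} → l ℕ.+ suc s ≡ n → suc l ℕ.+ s ≡ n
        level-up {l} {s} eq = trans (sym (+-suc l s)) eq

        -- The first row gives the B-recursion; valid down to level 1.
        window-side : ∀ l s → l < n → expand R l (suc s) (R 1) ≈ side (step l (window (suc l) s))
        window-side l s l<n = +-cong (*-cong (reflexive (entry-first n (<⇒≢ l<n))) ≈-refl) ≈-refl

        -- Right of the diagonal, row l is βₗ·(row 1) − (the unit vector at l+1),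
        -- the latter only when l+1 < n.
        beyond-diagonal : ∀ s l → 2 ≤ l → l ℕ.+ suc s ≡ n →
          expand R (suc l) s (R l) ≈ β l * expand R (suc l) s (R 1) + - window-next (suc l) s
        beyond-diagonal zero l 1<l eq = begin
          entry n l (suc l)        ≡⟨ trans (cong (entry n l) l+1≡n) (entry-column n l 1<l (below-n eq)) ⟩
          β l                      ≈⟨ *-identityʳ (β l) ⟨
          β l * 1#                 ≈⟨ +-identityʳ _ ⟨
          β l * 1# + 0#            ≈⟨ +-cong (*-cong ≈-refl (reflexive first≡1)) -0#≈0# ⟨
          β l * entry n 1 (suc l) + - 0# ∎
          where
          l+1≡n : suc l ≡ n
          l+1≡n = trans (sym (ℕₚ.+-identityʳ (suc l))) (level-up eq)
          first≡1 : entry n 1 (suc l) ≡ 1#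
          first≡1 = trans (cong (entry n 1) l+1≡n) (entry-first-last n)
        beyond-diagonal (suc s) l 1<l eq = begin
          R l (suc l) * A + expand R (suc (suc l)) s (R l)
            ≈⟨ +-cong (*-cong (reflexive (entry-super n l 1<l (below-n (level-up eq)))) ≈-refl)
                      (expand-linear R s (suc (suc l)) (β l)
                                     (λ j l+2≤j → entry-far n l j 1<l (below-n eq) l+2≤j)) ⟩
          (- 1# + β l * β (suc l)) * A + β l * B
            ≈⟨ +-cong (distribʳ A (- 1#) (β l * β (suc l))) ≈-refl ⟩
          (- 1# * A + (β l * β (suc l)) * A) + β l * B
            ≈⟨ +-cong (+-comm _ _) ≈-refl ⟩
          ((β l * β (suc l)) * A + - 1# * A) + β l * B
            ≈⟨ +-assoc _ _ _ ⟩
          (β l * β (suc l)) * A + (- 1# * A + β l * B)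
            ≈⟨ +-cong ≈-refl (+-comm _ _) ⟩
          (β l * β (suc l)) * A + (β l * B + - 1# * A)
            ≈⟨ +-assoc _ _ _ ⟨
          ((β l * β (suc l)) * A + β l * B) + - 1# * A
            ≈⟨ +-cong (≈-sym (*-over-lin (β l) (β (suc l)) A B)) (-1*x≈-x A) ⟩
          β l * (β (suc l) * A + B) + - A
            ≈⟨ +-cong (*-cong ≈-refl (+-cong (*-cong (reflexive (sym (entry-first n l+1≢n))) ≈-refl) ≈-refl)) ≈-refl ⟩
          β l * expand R (suc l) (suc s) (R 1) + - A ∎
          where
          A B : Carrier
          A = expand R (suc (suc l)) s (R (suc (suc l)))
          B = expand R (suc (suc l)) s (R 1)
          l+1≢n : suc l ≢ n
          l+1≢n = <⇒≢ (below-n (level-up eq))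

        -- The row l gives the A-recursion, using β_l² = 0.
        window-main : ∀ s l → 2 ≤ l → l ℕ.+ suc s ≡ n →
          main (step l (window (suc l) s)) ≈ expand R l (suc s) (R l)
        window-main s l 1<l eq = begin
          β l * (β l * A + B) + (a l * A + - N)  ≈⟨ +-cong (nilpotent-absorb (β l) A B (β²≈0 l (<⇒≤ 1<l))) ≈-refl ⟩
          β l * B + (a l * A + - N)              ≈⟨ x∙yz≈y∙xz _ _ _ ⟩
          a l * A + (β l * B + - N)              ≈⟨ +-cong (*-cong (reflexive (sym (entry-diag n l 1<l (below-n eq)))) ≈-refl)
                                                           (≈-sym (beyond-diagonal s l 1<l eq)) ⟩
          R l l * A + expand R (suc l) s (R l)   ∎
          where
          A B N : Carrier
          A = expand R (suc l) s (R (suc l))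
          B = expand R (suc l) s (R 1)
          N = window-next (suc l) s

        window-step : ∀ s l → 2 ≤ l → l ℕ.+ suc s ≡ n → step l (window (suc l) s) ≋ window l (suc s)
        window-step s l 1<l eq = window-main s l 1<l eq , ≈-refl , ≈-sym (window-side l s (below-n eq))

        window-run : ∀ s l → 2 ≤ l → l ℕ.+ s ≡ n → run l s ⟦ β n , 0# , 1# ⟧ ≋ window l s
        window-run zero l 1<l eq =
          reflexive (sym (trans (cong (λ m → entry n m m) l≡n) (entry-corner n (subst (2 ≤_) l≡n 1<l)))) ,
          ≈-refl ,
          reflexive (sym (trans (cong (entry n 1) l≡n) (entry-first-last n)))
          where
          l≡n : l ≡ n
          l≡n = trans (sym (ℕₚ.+-identityʳ l)) eq
        window-run (suc s) l 1<l eq =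
          ≋-trans (step-cong l (window-run s (suc l) (m≤n⇒m≤1+n 1<l) (level-up eq))) (window-step s l 1<l eq)

      doubles-ladder : ∀ k → doubles (suc k) ≡ ladder (λ _ → []) 2 k
      doubles-ladder zero = refl
      doubles-ladder (suc k) =
        trans (cong (_++ (suc (suc k) ∷ suc (suc k) ∷ [])) (doubles-ladder k))
              (trans (ladder-split (λ j → j ∷ j ∷ []) k 2) (ladder-rung (λ _ → []) k 2))

      P-run : ∀ k → P (suc (suc k)) ≈ side (run 1 (suc k) (Odd-ended.state (suc (suc k)) 0))
      P-run k = ≈-trans (reflexive (cong (λ w → ℰ (1 ∷ w))
                          (trans (cong (_++ [ suc (suc k) ]) (doubles-ladder k)) (ladder-split [_] k 2))))
                        (Odd-ended.leading k)

      Q-run : ∀ k → Q (suc k) ≈ side (run 1 (suc k) (Even-ended.state (suc (suc k)) 0))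
      Q-run k = ≈-trans (reflexive (cong (λ w → ℰ (1 ∷ w)) (doubles-ladder k))) (Even-ended.leading k)

      -- Q_{n−1} is odd: the run from ⟦ 1 , 0 , 0 ⟧ keeps the parity pattern.
      Q-odd : ∀ k → Odd (Q (suc k))
      Q-odd k = odd-resp (≈-sym (Q-run k)) (odd-+ (odd*even (β-odd 1 ≤-refl) e) o)
        where
        top-parity : EvenPattern (Even-ended.state (suc (suc k)) 0)
        top-parity = even-resp (≈-sym ℰ-empty) even-1 , even-0 , odd-0
        run-pattern : EvenPattern (run 2 k (Even-ended.state (suc (suc k)) 0))
        run-pattern = run-parity k 2 ≤-refl top-parity
        e : Even (main (run 2 k (Even-ended.state (suc (suc k)) 0)))
        e = proj₁ run-pattern
        o : Odd (side (run 2 k (Even-ended.state (suc (suc k)) 0)))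
        o = proj₂ (proj₂ run-pattern)

      -- P_{n−1}, seen from level n: the terminal triple ⟦ 0 , 0 , 1 ⟧.
      unit-top : Triple
      unit-top = ⟦ 0# , 0# , 1# ⟧

      unit-top-step : ∀ j → Odd-ended.state j 0 ≋ step j unit-top
      unit-top-step j = main≈ , ≈-refl , ≈-sym b≈1
        where
        b≈1 : β j * 0# + 1# ≈ 1#
        b≈1 = ≈-trans (+-cong (zeroʳ (β j)) ≈-refl) (+-identityˡ 1#)
        main≈ : ℰ [ j ] ≈ main (step j unit-top)
        main≈ = begin
          ℰ [ j ]                                         ≈⟨ ℰ-single j ⟩
          β j                                             ≈⟨ *-identityʳ (β j) ⟨
          β j * 1#                                        ≈⟨ +-identityʳ _ ⟨
          β j * 1# + 0#                                   ≈⟨ +-cong (*-cong ≈-refl b≈1)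
                                                                    (≈-trans (+-cong (zeroʳ (a j)) -0#≈0#) (+-identityʳ 0#)) ⟨
          β j * (β j * 0# + 1#) + (a j * 0# + - 0#)       ∎

      P-prev-run : ∀ k → P (suc k) ≈ side (run 1 (suc k) unit-top)
      P-prev-run zero = ≈-sym (≈-trans (+-cong (zeroʳ (β 1)) ≈-refl) (+-identityˡ 1#))
      P-prev-run (suc k) = ≈-trans (P-run k)
        (≈-trans (proj₂ (proj₂ (run-cong (suc k) 1 (unit-top-step (suc (suc k))))))
                 (reflexive (cong side (sym (run-peel 1 (suc k) unit-top)))))

      top-split : ∀ j → Odd-ended.state j 0 ≋ Even-ended.state j 0 ⊙ β j ⊞ unit-top
      top-split j =
        ≈-trans (ℰ-single j) (≈-sym (≈-trans (+-identityʳ _) (≈-trans (*-cong ℰ-empty ≈-refl) (*-identityˡ (β j))))) ,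
        ≈-sym (≈-trans (+-identityʳ _) (zeroˡ (β j))) ,
        ≈-sym (≈-trans (+-cong (zeroˡ (β j)) ≈-refl) (+-identityˡ 1#))

      recurrence : ∀ n → 2 ≤ n → P n ≈ (- (β n)) * Q (n ∸ 1) + P (n ∸ 1)
      recurrence (suc zero) (s≤s ())
      recurrence (suc (suc k)) _ = begin
        P n                                                            ≈⟨ P-run k ⟩
        side (run 1 (suc k) (Odd-ended.state n 0))                     ≈⟨ proj₂ (proj₂ (run-cong (suc k) 1 (top-split n))) ⟩
        side (run 1 (suc k) (Even-ended.state n 0 ⊙ β n ⊞ unit-top))   ≈⟨ proj₂ (proj₂ (run-linear (suc k) 1 _ unit-top (β n))) ⟩
        side (run 1 (suc k) (Even-ended.state n 0)) * β n + side (run 1 (suc k) unit-top)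
                                                                       ≈⟨ +-cong (*-cong (≈-sym (Q-run k)) ≈-refl) (≈-sym (P-prev-run k)) ⟩
        Q (suc k) * β n + P (suc k)                                    ≈⟨ +-cong (comm-oo (Q-odd k) (β-odd n (s≤s z≤n))) ≈-refl ⟩
        - (β n * Q (suc k)) + P (suc k)                                ≈⟨ +-cong (-‿distribˡ-* (β n) (Q (suc k))) ≈-refl ⟩
        (- β n) * Q (suc k) + P (suc k)                                ∎
        where
        n : ℕ
        n = suc (suc k)

      T-run : ∀ k → detcol (suc k) (T (suc (suc k))) ≈ side (run 1 (suc k) ⟦ β (suc (suc k)) , 0# , 1# ⟧)
      T-run k = begin
        detcol (suc k) (T n)                       ≈⟨ detcol-cong (suc k) as-stacked ⟩
        detcol (suc k) (stacked (suc k) first rows) ≈⟨ detcol-hessenberg (suc k) first rows sub low ⟩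
        hess (suc k) first rows                    ≡⟨ hess-window R (suc k) 1 (R 1) ⟩
        expand R 1 (suc k) (R 1)                   ≈⟨ window-side 1 k (s≤s (s≤s z≤n)) ⟩
        side (step 1 (window 2 k))                 ≈⟨ proj₂ (proj₂ (step-cong 1 (window-run k 2 ≤-refl refl))) ⟨
        side (run 1 (suc k) ⟦ β n , 0# , 1# ⟧)     ∎
        where
        n : ℕ
        n = suc (suc k)
        open Windows n
        first : ℕ → Carrier
        first j = R 1 (1 ℕ.+ j)
        rows : ℕ → ℕ → Carrier
        rows r c = R (suc (1 ℕ.+ r)) (1 ℕ.+ c)
        as-stacked : ∀ i j → T n i j ≈ stacked (suc k) first rows i j
        as-stacked fzero j = ≈-refl
        as-stacked (fsuc i) j = ≈-refl
        sub : ∀ c → c < suc k → rows c c ≈ - 1#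
        sub c c<k+1 = reflexive (entry-sub n c (s≤s c<k+1))
        low : ∀ r c → c < r → r < suc k → rows r c ≈ 0#
        low r c c<r r<k+1 = reflexive (entry-low n c<r (s≤s r<k+1))

      determinant : ∀ k → P (suc (suc k)) ≈ detcol (suc k) (T (suc (suc k)))
      determinant k = begin
        P n                                                ≈⟨ P-run k ⟩
        side (run 1 (suc k) (Odd-ended.state n 0))         ≈⟨ proj₂ (proj₂ (run-cong (suc k) 1 top≋)) ⟩
        side (run 1 (suc k) ⟦ β n , 0# , 1# ⟧)             ≈⟨ T-run k ⟨
        detcol (suc k) (T n)                               ∎
        where
        n : ℕ
        n = suc (suc k)
        top≋ : Odd-ended.state n 0 ≋ ⟦ β n , 0# , 1# ⟧
        top≋ = ℰ-single n , ≈-refl , ≈-refl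

theorem3 : ∀ {c ℓ} (S : SuperCommRing c ℓ) →
    let open SuperCommRing S in
    let open SC S in
    (a β : ℕ → Carrier) →
    (∀ i → 2 ≤ i → Even (a i)) →
    (∀ i → 1 ≤ i → Odd (β i)) →
    let open Seq a β in
    (∀ n → 2 ≤ n → P n ≈ (- (β n)) * Q (n ∸ 1) + P (n ∸ 1))
    × (∀ k → P (suc (suc k)) ≈ detcol (suc k) (T (suc (suc k))))
theorem3 S a β a-even β-odd = recurrence , determinant
  where open Development.Ladder.Graded S a β a-even β-odd
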